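{- Let $P$ be a finite poset with $n=|P|$ elements having a minimum $\hat0$ and a maximum $\hat1$, and fix an order ideal $I$ of $P$ with $I\ne\emptyset$ and $I\ne P$. Then there is a bijection $\Phi:\{(p,L)\mid L\in\mathcal{L}(P),\ p\in{\sf des}_I(L)\}\to\mathcal{L}(P)$ such that for every $(p,L)$ in the domain, $\Phi(p,L)$ lies in the same $\langle\tau_o,\tau_e\rangle$-orbit as $L$. In particular, the statistic $L\mapsto|{\sf des}_I(L)|$ is homomesic with respect to the action of $\langle\tau_o,\tau_e\rangle$ on $\mathcal{L}(P)$, with average value $1$ on every orbit.
   Context: $\mathcal{L}(P)$ is the set of linear extensions of $P$, i.e. bijections $L:P\to\{1,\ldots,n\}$ with $L(p)<L(q)$ whenever $p<q$. An order ideal is a subset $I\subseteq P$ closed downward. For $L\in\mathcal{L}(P)$, ${\sf des}_I(L)$ is the set of $p\in I$ with $L(p)<n$ such that $q=L^{ -1}(L(p)+1)$ satisfies $q\notin I$ and $q$ covers $p$ ($p\lessdot q$). For $1\le i<n$, $\tau_i$ acts on $\mathcal{L}(P)$ by interchanging the labels $i$ and $i+1$ of $L$ if the result is a linear extension, and fixing $L$ otherwise; $\tau_o=\prod_{i\text{ odd}}\tau_i$ and $\tau_e=\prod_{i\text{ even}}\tau_i$ (factors in each product commute). A statistic is homomesic with respect to a group action if its average over each orbit is the same constant. -}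

module Defs where

open import Data.Nat as ℕ using (ℕ; zero; suc; _∸_)
open import Data.Bool using (Bool; true; false; if_then_else_)
import Data.Bool
import Data.Sum
open import Data.Fin as Fin using (Fin; toℕ)
open import Data.Fin.Properties using (any?; all?)
open import Data.Fin.Subset using (Subset; _∈_; _∉_)
open import Data.Fin.Subset.Properties using (_∈?_)
open import Data.Vec using (Vec; []; _∷_; lookup)
open import Data.List as List using (List; []; _∷_; upTo; allFin; filter; length)
open import Data.Product using (Σ; ∃; _×_; _,_)
open import Relation.Nullary using (¬_; Dec; yes; no; does)
open import Relation.Nullary.Decidable using (_×-dec_; ¬?; _→-dec_)
open import Relation.Binary using (IsPartialOrder; Decidable)
open import Relation.Binary.PropositionalEquality using (_≡_; _≢_)
open import Relation.Binary.Construct.Closure.Equivalence using (EqClosure)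

record FinPoset (n : ℕ) : Set₁ where
  field
    _≼_            : Fin n → Fin n → Set
    isPartialOrder : IsPartialOrder _≡_ _≼_
    _≼?_           : Decidable _≼_

module _ {n : ℕ} (P : FinPoset n) where
  open FinPoset P

  _≺_ : Fin n → Fin n → Set
  p ≺ q = (p ≼ q) × (p ≢ q)

  _⋖_ : Fin n → Fin n → Set
  p ⋖ q = (p ≺ q) × (∀ r → ¬ ((p ≺ r) × (r ≺ q)))

  _≺?_ : Decidable _≺_
  p ≺? q = (p ≼? q) ×-dec ¬? (p Fin.≟ q)

  _⋖?_ : Decidable _⋖_
  p ⋖? q = (p ≺? q) ×-dec all? (λ r → ¬? ((p ≺? r) ×-dec (r ≺? q)))

  HasMinimum : Set
  HasMinimum = ∃ λ z → ∀ p → z ≼ p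

  HasMaximum : Set
  HasMaximum = ∃ λ t → ∀ p → p ≼ t

  IsOrderIdeal : Subset n → Set
  IsOrderIdeal I = ∀ p q → q ∈ I → p ≼ q → p ∈ I

  -- A linear extension L : P → {1,…,n} is represented by its inverse, the
  -- word w : Vec (Fin n) n with  lookup w k = L⁻¹(k+1)  (positions are
  -- 0-indexed, labels 1-indexed).  w must be injective (hence a bijection
  -- Fin n → Fin n) and order preserving.
  IsLinExt : Vec (Fin n) n → Set
  IsLinExt w = (∀ i j → lookup w i ≡ lookup w j → i ≡ j)
             × (∀ i j → lookup w i ≺ lookup w j → toℕ i ℕ.< toℕ j)

  isLinExt? : (w : Vec (Fin n) n) → Dec (IsLinExt w)
  isLinExt? w =
    all? (λ i → all? (λ j → (lookup w i Fin.≟ lookup w j) →-dec (i Fin.≟ j)))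
    ×-dec all? (λ i → all? (λ j → (lookup w i ≺? lookup w j) →-dec (toℕ i ℕ.<? toℕ j)))

  InDes : Subset n → Vec (Fin n) n → Fin n → Set
  InDes I w p = (p ∈ I) × Σ (Fin n) λ i → Σ (Fin n) λ j →
      (lookup w i ≡ p) × (toℕ j ≡ suc (toℕ i)) × (lookup w j ∉ I) × (p ⋖ lookup w j)

  inDes? : (I : Subset n) (w : Vec (Fin n) n) (p : Fin n) → Dec (InDes I w p)
  inDes? I w p = (p ∈? I) ×-dec any? (λ i → any? (λ j →
      (lookup w i Fin.≟ p) ×-dec (toℕ j ℕ.≟ suc (toℕ i))
      ×-dec ¬? (lookup w j ∈? I) ×-dec (p ⋖? lookup w j)))

  desCount : Subset n → Vec (Fin n) n → ℕ
  desCount I w = length (filter (inDes? I w) (allFin n))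

swapAdj : {A : Set} {m : ℕ} → ℕ → Vec A m → Vec A m
swapAdj zero    (x ∷ y ∷ xs) = y ∷ x ∷ xs
swapAdj zero    xs           = xs
swapAdj (suc k) []           = []
swapAdj (suc k) (x ∷ xs)     = x ∷ swapAdj k xs

isOdd : ℕ → Bool
isOdd zero          = false
isOdd (suc zero)    = true
isOdd (suc (suc k)) = isOdd k

module _ {n : ℕ} (P : FinPoset n) where

  -- τ_i (1 ≤ i < n): interchange labels i and i+1, i.e. positions i-1 and i
  -- of the word, if the result is a linear extension; otherwise fix L.
  τ : ℕ → Vec (Fin n) n → Vec (Fin n) n
  τ i w = if does (isLinExt? P (swapAdj (i ∸ 1) w)) then swapAdj (i ∸ 1) w else w

  labels : List ℕ
  labels = List.map suc (upTo (n ∸ 1))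

  applyAll : List ℕ → Vec (Fin n) n → Vec (Fin n) n
  applyAll is w = List.foldr τ w is

  τₒ : Vec (Fin n) n → Vec (Fin n) n
  τₒ = applyAll (filter (λ i → isOdd i Data.Bool.≟ true) labels)

  τₑ : Vec (Fin n) n → Vec (Fin n) n
  τₑ = applyAll (filter (λ i → isOdd i Data.Bool.≟ false) labels)

  Step : Vec (Fin n) n → Vec (Fin n) n → Set
  Step w w' = (w' ≡ τₒ w) Data.Sum.⊎ (w' ≡ τₑ w)

  SameOrbit : Vec (Fin n) n → Vec (Fin n) n → Set
  SameOrbit = EqClosure Step

module Submission where

-- A linear extension is a word listing the elements of P.  On linear
-- extensions τ_i swaps the letters at positions i-1, i exactly when they are
-- incomparable, so τₒ sorts the pairs at positions (0,1),(2,3),… into the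
-- order of P (call this sw) and τₑ those at (1,2),(3,4),… (sw′).  A letter is
-- an I-descent iff it is the first letter of an adjacent pair (x, y) with
-- x ∈ I, y ∉ I and x < y.  A pair leaving I is either such a descent, or is
-- incomparable and then enters I after sw (resp. sw′) swaps it; and along a
-- word from 0̂ ∈ I to 1̂ ∉ I the pairs leaving I exceed those entering I by
-- one.  Summing over an orbit, which sw and sw′ permute, gives
-- Σ |des_I| = |orbit|.

open import Data.Bool as Bool using (Bool; true; false; if_then_else_; _∧_; not)
open import Data.Empty using (⊥-elim)
open import Data.Fin as Fin using (Fin; zero; suc; toℕ)
import Data.Fin.Properties as Finₚ
open import Data.Fin.Subset using (Subset; _∉_; Nonempty)
open import Data.List as List using (List; []; _∷_; _++_; map; length; filter)
open import Data.List.Membership.Propositional as ListMem using (_∈_)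
open import Data.List.Membership.Propositional.Properties
  using (∈-∃++; ∈-lookup; ∈-map⁺; ∈-map⁻; ∈-tabulate⁺; ∈-allFin; ∈-filter⁺; ∈-filter⁻;
         ∈-cartesianProduct⁺; ∈-cartesianProduct⁻)
open import Data.List.Membership.Setoid.Properties using () renaming (index-injective to index-injectiveₛ)
open import Data.List.Properties
  using (map-∘; map-cong; map-cong-local; map-applyUpTo; foldr-map; filter-≐; filter-++; length-++)
import Data.List.Relation.Unary.All as All
import Data.List.Relation.Unary.All.Properties as AllP
open import Data.List.Relation.Unary.AllPairs as AllPairs using ([]; _∷_)
open import Data.List.Relation.Unary.Any using (here; there; index)
open import Data.List.Relation.Unary.Any.Properties using (lookup-index)
open import Data.List.Relation.Unary.Unique.Propositional using (Unique)
import Data.List.Relation.Unary.Unique.Propositional.Properties as UniqueP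
open import Data.List.Relation.Binary.Permutation.Propositional using (_↭_; ↭-sym; ↭-trans; ↭-prep; ↭⇒↭ₛ)
open import Data.List.Relation.Binary.Permutation.Propositional.Properties
  using (shift; ∈-resp-↭; map⁺; ↭-length; filter-↭)
import Data.List.Relation.Binary.Permutation.Setoid.Properties as ↭ₛ
open import Data.Nat using (ℕ; zero; suc; _+_; _*_; _∸_; _<_; _≤_; z≤n; s≤s; s<s⁻¹)
open import Data.Nat.DivMod using (_%_; _/_; m≡m%n+[m/n]*n; m%n<n)
open import Data.Nat.ListAction using (sum)
open import Data.Nat.ListAction.Properties using (sum-↭)
import Data.Nat.Properties as ℕₚ
open import Algebra.Properties.CommutativeSemigroup ℕₚ.+-commutativeSemigroup
  using (x∙yz≈xz∙y; xy∙z≈xz∙y) renaming (interchange to +-interchange)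
open import Data.Product using (Σ; ∃; _×_; _,_; proj₁; proj₂; uncurry)
open import Data.Product.Properties using (×-≡,≡→≡; ×-≡,≡←≡)
open import Data.Sum as Sum using (_⊎_; inj₁; inj₂)
open import Data.Unit using (⊤; tt)
open import Data.Vec as V using (Vec; []; _∷_)
open import Data.Vec.Membership.Propositional using () renaming (_∈_ to _V∈_)
open import Data.Vec.Membership.Propositional.Properties using () renaming (∈-lookup to V∈-lookup)
open import Data.Vec.Properties using ([]=⇒lookup; lookup⇒[]=)
import Data.Vec.Properties as Vecₚ
import Data.Vec.Relation.Unary.All as VAll
open VAll using ([]; _∷_)
import Data.Vec.Relation.Unary.All.Properties as VAllP
import Data.Vec.Relation.Unary.Any as VAny
open import Function using (_∘_; case_of_)
open import Function.Bundles using (_⇔_; Equivalence)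
open import Relation.Binary using (Decidable)
open import Relation.Binary.Construct.Closure.Equivalence using (EqClosure)
open import Relation.Binary.Construct.Closure.ReflexiveTransitive using (ε; _◅_; _◅◅_)
open import Relation.Binary.Construct.Closure.Symmetric using (fwd)
open import Relation.Binary.Definitions using (DecidableEquality)
open import Relation.Binary.PropositionalEquality
open import Relation.Nullary using (¬_; Dec; yes; no; does)
import Relation.Nullary.Decidable as Dec
open import Relation.Nullary.Decidable using (_⊎-dec_)
import Relation.Unary as U
open import Defs

module ListFacts where

  unique-↭ : {A : Set} {xs ys : List A} → Unique xs → Unique ys →
    (∀ {z} → z ∈ xs → z ∈ ys) → (∀ {z} → z ∈ ys → z ∈ xs) → xs ↭ ys
  unique-↭ {xs = []} {[]} _ _ _ _ = _↭_.refl
  unique-↭ {xs = []} {y ∷ ys} _ _ _ ys⊆xs = case ys⊆xs (here refl) of λ ()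
  unique-↭ {A} {x ∷ xs} {ys} (x∉xs ∷ uxs) uys xs⊆ys ys⊆xs
    with as , bs , refl ← ∈-∃++ (xs⊆ys (here refl)) =
    ↭-trans (↭-prep x (unique-↭ uxs urest to from)) (↭-sym (shift x as bs))
    where
    pull : as ++ x ∷ bs ↭ x ∷ (as ++ bs)
    pull = shift x as bs
    upulled : Unique (x ∷ (as ++ bs))
    upulled = ↭ₛ.Unique-resp-↭ (setoid A) (↭⇒↭ₛ pull) uys
    x∉rest : All.All (x ≢_) (as ++ bs)
    x∉rest = AllPairs.head upulled
    urest : Unique (as ++ bs)
    urest = AllPairs.tail upulled
    to : ∀ {z} → z ∈ xs → z ∈ as ++ bs
    to z∈xs with ∈-resp-↭ pull (xs⊆ys (there z∈xs))
    ... | here refl = case All.lookup x∉xs z∈xs refl of λ ()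
    ... | there z∈rest = z∈rest
    from : ∀ {z} → z ∈ as ++ bs → z ∈ xs
    from z∈rest with ys⊆xs (∈-resp-↭ (↭-sym pull) (there z∈rest))
    ... | here refl = case All.lookup x∉rest z∈rest refl of λ ()
    ... | there z∈xs = z∈xs

  map-unique : {A B : Set} (f : A → B) {xs : List A} → Unique xs →
    (∀ {x y} → x ∈ xs → y ∈ xs → f x ≡ f y → x ≡ y) → Unique (map f xs)
  map-unique f {[]} _ _ = []
  map-unique f {x ∷ xs} (x∉xs ∷ uxs) inj =
    AllP.map⁺ (All.tabulate λ y∈xs fx≡fy → All.lookup x∉xs y∈xs (inj (here refl) (there y∈xs) fx≡fy))
    ∷ map-unique f uxs (λ x∈ y∈ → inj (there x∈) (there y∈))

  sum-involution : {A : Set} (f : A → A) (h : A → ℕ) {O : List A} → Unique O →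
    (∀ {x} → x ∈ O → f x ∈ O) → (∀ {x} → x ∈ O → f (f x) ≡ x) →
    sum (map (h ∘ f) O) ≡ sum (map h O)
  sum-involution f h {O} uO closed invol = begin
    sum (map (h ∘ f) O)     ≡⟨ cong sum (map-∘ O) ⟩
    sum (map h (map f O))   ≡⟨ sum-↭ (map⁺ h fO↭O) ⟩
    sum (map h O)           ∎
    where
    open ≡-Reasoning
    fO↭O : map f O ↭ O
    fO↭O = unique-↭
      (map-unique f uO λ x∈ y∈ fx≡fy → trans (sym (invol x∈)) (trans (cong f fx≡fy) (invol y∈)))
      uO
      (λ z∈fO → let x , x∈O , z≡fx = ∈-map⁻ f z∈fO in subst (_∈ O) (sym z≡fx) (closed x∈O))
      (λ z∈O → subst (_∈ map f O) (invol z∈O) (∈-map⁺ f (closed z∈O)))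

  sum-map-+ : {A : Set} (f g : A → ℕ) (xs : List A) →
    sum (map (λ x → f x + g x) xs) ≡ sum (map f xs) + sum (map g xs)
  sum-map-+ f g [] = refl
  sum-map-+ f g (x ∷ xs) = begin
    (f x + g x) + sum (map (λ x → f x + g x) xs) ≡⟨ cong ((f x + g x) +_) (sum-map-+ f g xs) ⟩
    (f x + g x) + (sum (map f xs) + sum (map g xs)) ≡⟨ +-interchange (f x) (g x) _ _ ⟩
    (f x + sum (map f xs)) + (g x + sum (map g xs)) ∎
    where open ≡-Reasoning

  index-unique : {A : Set} {x : A} {xs : List A} → Unique xs → (p q : x ∈ xs) → index p ≡ index q
  index-unique _          (here refl) (here refl) = refl
  index-unique (x∉ ∷ _)   (here refl) (there q)   = case All.lookup x∉ q refl of λ ()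
  index-unique (x∉ ∷ _)   (there p)   (here refl) = case All.lookup x∉ p refl of λ ()
  index-unique (_ ∷ uxs)  (there p)   (there q)   = cong suc (index-unique uxs p q)

  lookup-unique : {A : Set} {xs : List A} → Unique xs → (i j : Fin (length xs)) →
    List.lookup xs i ≡ List.lookup xs j → i ≡ j
  lookup-unique {xs = x ∷ xs} _ zero zero _ = refl
  lookup-unique {xs = x ∷ xs} (x∉ ∷ _) zero (suc j) x≡ = case All.lookup x∉ (∈-lookup j) x≡ of λ ()
  lookup-unique {xs = x ∷ xs} (x∉ ∷ _) (suc i) zero ≡x = case All.lookup x∉ (∈-lookup i) (sym ≡x) of λ ()
  lookup-unique {xs = x ∷ xs} (_ ∷ uxs) (suc i) (suc j) eq = cong suc (lookup-unique uxs i j eq)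

  index-∈-lookup : {A : Set} (xs : List A) (i : Fin (length xs)) → index (∈-lookup {xs = xs} i) ≡ i
  index-∈-lookup (x ∷ xs) zero = refl
  index-∈-lookup (x ∷ xs) (suc i) = cong suc (index-∈-lookup xs i)

  length-filter-map : {A B : Set} {Q : B → Set} (Q? : U.Decidable Q) (f : A → B) (xs : List A) →
    length (filter Q? (map f xs)) ≡ length (filter (Q? ∘ f) xs)
  length-filter-map Q? f []       = refl
  length-filter-map Q? f (x ∷ xs) with does (Q? (f x))
  ... | true  = cong suc (length-filter-map Q? f xs)
  ... | false = length-filter-map Q? f xs

  sum-ones : {A : Set} (xs : List A) → sum (map (λ _ → 1) xs) ≡ length xs
  sum-ones []       = refl
  sum-ones (x ∷ xs) = cong suc (sum-ones xs)

-- Two duplicate-free lists of the same length are in bijection by matching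
-- equal positions.  The bijection is expressed on membership proofs.
module IndexMatching {A B : Set} (xs : List A) (ys : List B) .(same-length : length xs ≡ length ys) where
  open ListFacts

  match : {x : A} → x ∈ xs → B
  match x∈xs = List.lookup ys (Fin.cast same-length (index x∈xs))

  match-∈ : {x : A} (x∈xs : x ∈ xs) → match x∈xs ∈ ys
  match-∈ x∈xs = ∈-lookup _

  match-irrelevant : Unique xs → {x : A} (p q : x ∈ xs) → match p ≡ match q
  match-irrelevant uxs p q = cong (List.lookup ys ∘ Fin.cast same-length) (index-unique uxs p q)

  match-injective : Unique ys → {x x′ : A} (p : x ∈ xs) (q : x′ ∈ xs) → match p ≡ match q → x ≡ x′
  match-injective uys p q eq = index-injectiveₛ (setoid A) p q (begin
    index p                                   ≡⟨ Finₚ.cast-involutive (sym same-length) same-length (index p) ⟨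
    back (Fin.cast same-length (index p))     ≡⟨ cong back (lookup-unique uys _ _ eq) ⟩
    back (Fin.cast same-length (index q))     ≡⟨ Finₚ.cast-involutive (sym same-length) same-length (index q) ⟩
    index q                                   ∎)
    where
    open ≡-Reasoning
    back : Fin (length ys) → Fin (length xs)
    back = Fin.cast (sym same-length)

  match-surjective : {y : B} → y ∈ ys → ∃ λ x → Σ (x ∈ xs) λ p → match p ≡ y
  match-surjective y∈ys = _ , ∈-lookup i , (begin
    List.lookup ys (Fin.cast same-length (index (∈-lookup {xs = xs} i)))
      ≡⟨ cong (List.lookup ys ∘ Fin.cast same-length) (index-∈-lookup xs i) ⟩
    List.lookup ys (Fin.cast same-length i)
      ≡⟨ cong (List.lookup ys) (Finₚ.cast-involutive same-length (sym same-length) (index y∈ys)) ⟩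
    List.lookup ys (index y∈ys)
      ≡⟨ lookup-index y∈ys ⟨
    _ ∎)
    where
    open ≡-Reasoning
    i : Fin (length xs)
    i = Fin.cast (sym same-length) (index y∈ys)

-- The generators τₒ, τₑ of Defs are folds over the odd resp. even labels
-- 1, …, m; label i acts at the word positions i-1, i.  We list these
-- positions explicitly.
module Parity where

  evenPositions oddPositions : ℕ → List ℕ
  evenPositions zero          = []
  evenPositions (suc zero)    = 0 ∷ []
  evenPositions (suc (suc m)) = 0 ∷ map (2 +_) (evenPositions m)
  oddPositions zero          = []
  oddPositions (suc zero)    = []
  oddPositions (suc (suc m)) = 1 ∷ map (2 +_) (oddPositions m)

  private
    labels-step : (m : ℕ) → map suc (List.upTo (2 + m)) ≡ 1 ∷ 2 ∷ map (2 +_) (map suc (List.upTo m))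
    labels-step m = cong (λ t → 1 ∷ 2 ∷ t)
      (trans (map-applyUpTo _ suc m) (sym (trans (cong (map (2 +_)) (map-applyUpTo _ suc m)) (map-applyUpTo _ (2 +_) m))))

    -- parity is invariant under adding 2
    filter-shift : (c : Bool) (xs : List ℕ) →
      filter (λ i → isOdd i Bool.≟ c) (map (2 +_) xs) ≡ map (2 +_) (filter (λ i → isOdd i Bool.≟ c) xs)
    filter-shift c []       = refl
    filter-shift c (x ∷ xs) with isOdd x Bool.≟ c
    ... | yes _ = cong (2 + x ∷_) (filter-shift c xs)
    ... | no  _ = filter-shift c xs

    suc-shift : (xs : List ℕ) → map (2 +_) (map suc xs) ≡ map suc (map (2 +_) xs)
    suc-shift xs = trans (sym (map-∘ xs)) (map-∘ xs)

  odd-labels : (m : ℕ) → filter (λ i → isOdd i Bool.≟ true) (map suc (List.upTo m)) ≡ map suc (evenPositions m)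
  odd-labels zero          = refl
  odd-labels (suc zero)    = refl
  odd-labels (suc (suc m)) = begin
    filter odd? (map suc (List.upTo (2 + m)))            ≡⟨ cong (filter odd?) (labels-step m) ⟩
    1 ∷ filter odd? (map (2 +_) (map suc (List.upTo m))) ≡⟨ cong (1 ∷_) (filter-shift true (map suc (List.upTo m))) ⟩
    1 ∷ map (2 +_) (filter odd? (map suc (List.upTo m))) ≡⟨ cong (λ t → 1 ∷ map (2 +_) t) (odd-labels m) ⟩
    1 ∷ map (2 +_) (map suc (evenPositions m))          ≡⟨ cong (1 ∷_) (suc-shift (evenPositions m)) ⟩
    1 ∷ map suc (map (2 +_) (evenPositions m))          ∎
    where
    open ≡-Reasoning
    odd? : U.Decidable (λ i → isOdd i ≡ true)
    odd? i = isOdd i Bool.≟ true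

  even-labels : (m : ℕ) → filter (λ i → isOdd i Bool.≟ false) (map suc (List.upTo m)) ≡ map suc (oddPositions m)
  even-labels zero          = refl
  even-labels (suc zero)    = refl
  even-labels (suc (suc m)) = begin
    filter even? (map suc (List.upTo (2 + m)))            ≡⟨ cong (filter even?) (labels-step m) ⟩
    2 ∷ filter even? (map (2 +_) (map suc (List.upTo m))) ≡⟨ cong (2 ∷_) (filter-shift false (map suc (List.upTo m))) ⟩
    2 ∷ map (2 +_) (filter even? (map suc (List.upTo m))) ≡⟨ cong (λ t → 2 ∷ map (2 +_) t) (even-labels m) ⟩
    2 ∷ map (2 +_) (map suc (oddPositions m))            ≡⟨ cong (2 ∷_) (suc-shift (oddPositions m)) ⟩
    2 ∷ map suc (map (2 +_) (oddPositions m))            ∎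
    where
    open ≡-Reasoning
    even? : U.Decidable (λ i → isOdd i ≡ false)
    even? i = isOdd i Bool.≟ false

module Words {A : Set} (_≺_ : A → A → Set) (_≺?_ : Decidable _≺_) where
  open Parity using (evenPositions; oddPositions)

  LinWord : {m : ℕ} → Vec A m → Set
  LinWord []      = ⊤
  LinWord (x ∷ r) = VAll.All (λ y → x ≢ y × ¬ (y ≺ x)) r × LinWord r

  IndexLinear : {m : ℕ} → Vec A m → Set
  IndexLinear w = (∀ i j → V.lookup w i ≡ V.lookup w j → i ≡ j)
                × (∀ i j → V.lookup w i ≺ V.lookup w j → toℕ i < toℕ j)

  indexLinear⇒linWord : {m : ℕ} (w : Vec A m) → IndexLinear w → LinWord w
  indexLinear⇒linWord []      _           = tt
  indexLinear⇒linWord (x ∷ r) (inj , ord) =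
    VAllP.lookup⁻ (λ j → (λ x≡ → case inj zero (suc j) x≡ of λ ()) ,
                         (λ ≺x → case ord (suc j) zero ≺x of λ ())) ,
    indexLinear⇒linWord r ((λ i j eq → Finₚ.suc-injective (inj (suc i) (suc j) eq)) ,
                           (λ i j lt → s<s⁻¹ (ord (suc i) (suc j) lt)))

  linWord⇒indexLinear : (∀ {x} → ¬ (x ≺ x)) → {m : ℕ} (w : Vec A m) → LinWord w → IndexLinear w
  linWord⇒indexLinear irrefl []      _         = (λ ()) , (λ ())
  linWord⇒indexLinear irrefl (x ∷ r) (above , lr) = inj , ord
    where
    inj′ : ∀ i j → V.lookup r i ≡ V.lookup r j → i ≡ j
    inj′ = proj₁ (linWord⇒indexLinear irrefl r lr)
    ord′ : ∀ i j → V.lookup r i ≺ V.lookup r j → toℕ i < toℕ j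
    ord′ = proj₂ (linWord⇒indexLinear irrefl r lr)
    inj : ∀ i j → V.lookup (x ∷ r) i ≡ V.lookup (x ∷ r) j → i ≡ j
    inj zero    zero    _  = refl
    inj zero    (suc j) eq = ⊥-elim (proj₁ (VAllP.lookup⁺ above j) eq)
    inj (suc i) zero    eq = ⊥-elim (proj₁ (VAllP.lookup⁺ above i) (sym eq))
    inj (suc i) (suc j) eq = cong suc (inj′ i j eq)
    ord : ∀ i j → V.lookup (x ∷ r) i ≺ V.lookup (x ∷ r) j → toℕ i < toℕ j
    ord zero    zero    x≺x = ⊥-elim (irrefl x≺x)
    ord zero    (suc j) _   = s≤s z≤n
    ord (suc i) zero    ≺x  = ⊥-elim (proj₂ (VAllP.lookup⁺ above i) ≺x)
    ord (suc i) (suc j) lt  = s≤s (ord′ i j lt)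

  swIf : {m : ℕ} → ℕ → Vec A m → Vec A m
  swIf zero    []          = []
  swIf zero    (x ∷ [])    = x ∷ []
  swIf zero    (x ∷ y ∷ r) = if does (x ≺? y) then x ∷ y ∷ r else y ∷ x ∷ r
  swIf (suc k) []          = []
  swIf (suc k) (x ∷ r)     = x ∷ swIf k r

  sw : {m : ℕ} → Vec A m → Vec A m
  sw []          = []
  sw (x ∷ [])    = x ∷ []
  sw (x ∷ y ∷ r) = swIf 0 (x ∷ y ∷ sw r)

  sw′ : {m : ℕ} → Vec A m → Vec A m
  sw′ []      = []
  sw′ (x ∷ r) = x ∷ sw r

  All-swapAdj : {P : A → Set} {m : ℕ} (k : ℕ) {r : Vec A m} → VAll.All P r → VAll.All P (swapAdj k r)
  All-swapAdj zero    (px ∷ py ∷ ps) = py ∷ px ∷ ps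
  All-swapAdj zero    []             = []
  All-swapAdj zero    (px ∷ [])      = px ∷ []
  All-swapAdj (suc k) []             = []
  All-swapAdj (suc k) (px ∷ ps)      = px ∷ All-swapAdj k ps

  swapAdj-linear : {m : ℕ} (k : ℕ) {w : Vec A m} → LinWord w →
    (LinWord (swapAdj k w) × swIf k w ≡ swapAdj k w) ⊎ (¬ LinWord (swapAdj k w) × swIf k w ≡ w)
  swapAdj-linear zero {[]}        lw = inj₁ (lw , refl)
  swapAdj-linear zero {x ∷ []}    lw = inj₁ (lw , refl)
  swapAdj-linear zero {x ∷ y ∷ r} (((x≢y , _) ∷ x-above) , y-above , lr) with x ≺? y
  ... | yes x≺y = inj₂ ((λ where (((_ , x⊀y) ∷ _) , _) → x⊀y x≺y) , refl)
  ... | no  x⊀y = inj₁ ((((x≢y ∘ sym) , x⊀y) ∷ y-above , x-above , lr) , refl)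
  swapAdj-linear (suc k) {[]}     lw = inj₁ (lw , refl)
  swapAdj-linear (suc k) {x ∷ r}  (x-above , lr) with swapAdj-linear k lr
  ... | inj₁ (lr′ , eq) = inj₁ ((All-swapAdj k x-above , lr′) , cong (x ∷_) eq)
  ... | inj₂ (¬lr′ , eq) = inj₂ (¬lr′ ∘ proj₂ , cong (x ∷_) eq)

  sw-involutive : {m : ℕ} (w : Vec A m) → LinWord w → sw (sw w) ≡ w
  sw-involutive []          _ = refl
  sw-involutive (x ∷ [])    _ = refl
  sw-involutive (x ∷ y ∷ r) ((_ ∷ _) , y-above , lr) with x ≺? y
  ... | yes x≺y with x ≺? y
  ...   | yes _   = cong (λ t → x ∷ y ∷ t) (sw-involutive r lr)
  ...   | no  x⊀y = ⊥-elim (x⊀y x≺y)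
  sw-involutive (x ∷ y ∷ r) (((_ , y⊀x) ∷ _) , _ , lr) | no _ with y ≺? x
  ...   | yes y≺x = ⊥-elim (y⊀x y≺x)
  ...   | no  _   = cong (λ t → x ∷ y ∷ t) (sw-involutive r lr)

  sw′-involutive : {m : ℕ} (w : Vec A m) → LinWord w → sw′ (sw′ w) ≡ w
  sw′-involutive []      _         = refl
  sw′-involutive (x ∷ r) (_ , lr) = cong (x ∷_) (sw-involutive r lr)

  -- Applying swIf at the positions 0, 2, 4, … (resp. 1, 3, 5, …) of a word
  -- is sw (resp. sw′): these positions act on disjoint pairs.
  foldr-swIf-shift : {m : ℕ} (x y : A) (r : Vec A m) (ks : List ℕ) →
    List.foldr swIf (x ∷ y ∷ r) (map (2 +_) ks) ≡ x ∷ y ∷ List.foldr swIf r ks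
  foldr-swIf-shift x y r []       = refl
  foldr-swIf-shift x y r (k ∷ ks) = cong (swIf (2 + k)) (foldr-swIf-shift x y r ks)

  foldr-swIf-even : (m : ℕ) (w : Vec A (suc m)) → List.foldr swIf w (evenPositions m) ≡ sw w
  foldr-swIf-even zero          (x ∷ [])    = refl
  foldr-swIf-even (suc zero)    (x ∷ y ∷ []) = refl
  foldr-swIf-even (suc (suc m)) (x ∷ y ∷ r) =
    cong (swIf 0) (trans (foldr-swIf-shift x y r (evenPositions m))
                         (cong (λ t → x ∷ y ∷ t) (foldr-swIf-even m r)))

  foldr-swIf-odd : (m : ℕ) (w : Vec A (suc m)) → List.foldr swIf w (oddPositions m) ≡ sw′ w
  foldr-swIf-odd zero          (x ∷ [])        = refl
  foldr-swIf-odd (suc zero)    (x ∷ y ∷ [])    = refl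
  foldr-swIf-odd (suc (suc m)) (x ∷ y ∷ z ∷ r) =
    cong (swIf 1) (trans (foldr-swIf-shift x y (z ∷ r) (oddPositions m))
                         (cong (λ t → x ∷ y ∷ t) (foldr-swIf-odd m (z ∷ r))))

module Crossings {A : Set} (_≺_ : A → A → Set) (_≺?_ : Decidable _≺_)
                 (b : A → Bool) (down-closed : ∀ {x y} → x ≺ y → b y ≡ true → b x ≡ true) where
  open Words _≺_ _≺?_
  open ListFacts

  𝟙 : Bool → ℕ
  𝟙 true  = 1
  𝟙 false = 0

  leaves enters descent : A → A → ℕ
  leaves  x y = 𝟙 (b x ∧ not (b y))
  enters  x y = 𝟙 (not (b x) ∧ b y)
  descent x y = 𝟙 (b x ∧ not (b y) ∧ does (x ≺? y))

  evenPairs oddPairs allPairs : (A → A → ℕ) → {m : ℕ} → Vec A m → ℕ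
  evenPairs f []          = 0
  evenPairs f (x ∷ [])    = 0
  evenPairs f (x ∷ y ∷ r) = f x y + evenPairs f r
  oddPairs f []      = 0
  oddPairs f (x ∷ r) = evenPairs f r
  allPairs f []          = 0
  allPairs f (x ∷ [])    = 0
  allPairs f (x ∷ y ∷ r) = f x y + allPairs f (y ∷ r)

  allPairs-split : (f : A → A → ℕ) {m : ℕ} (w : Vec A m) → allPairs f w ≡ evenPairs f w + oddPairs f w
  allPairs-split f []          = refl
  allPairs-split f (x ∷ [])    = refl
  allPairs-split f (x ∷ y ∷ r) = begin
    f x y + allPairs f (y ∷ r)                    ≡⟨ cong (f x y +_) (allPairs-split f (y ∷ r)) ⟩
    f x y + (evenPairs f (y ∷ r) + evenPairs f r) ≡⟨ cong (f x y +_) (ℕₚ.+-comm (evenPairs f (y ∷ r)) _) ⟩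
    f x y + (evenPairs f r + evenPairs f (y ∷ r)) ≡⟨ ℕₚ.+-assoc (f x y) _ _ ⟨
    (f x y + evenPairs f r) + evenPairs f (y ∷ r) ∎
    where open ≡-Reasoning

  -- A pair that leaves the set is either a descent, or (when its letters are
  -- not ≺-ordered) becomes a pair entering the set once sw swaps it.
  leaves-ordered : ∀ x y → x ≺ y → leaves x y ≡ 𝟙 (b x ∧ not (b y) ∧ true) + enters x y
  leaves-ordered x y x≺y with b x in bx | b y in by
  ... | true  | true  = refl
  ... | true  | false = refl
  ... | false | false = refl
  ... | false | true  = case trans (sym bx) (down-closed x≺y by) of λ ()

  leaves-unordered : ∀ x y → leaves x y ≡ 𝟙 (b x ∧ not (b y) ∧ false) + enters y x
  leaves-unordered x y with b x | b y
  ... | true  | true  = refl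
  ... | true  | false = refl
  ... | false | true  = refl
  ... | false | false = refl

  leaves-even : {m : ℕ} (w : Vec A m) → evenPairs leaves w ≡ evenPairs descent w + evenPairs enters (sw w)
  leaves-even []          = refl
  leaves-even (x ∷ [])    = refl
  leaves-even (x ∷ y ∷ r) with x ≺? y
  ... | yes x≺y = trans (cong₂ _+_ (leaves-ordered x y x≺y) (leaves-even r))
                        (+-interchange (𝟙 (b x ∧ not (b y) ∧ true)) (enters x y) _ _)
  ... | no  _   = trans (cong₂ _+_ (leaves-unordered x y) (leaves-even r))
                        (+-interchange (𝟙 (b x ∧ not (b y) ∧ false)) (enters y x) _ _)

  leaves-odd : {m : ℕ} (w : Vec A m) → oddPairs leaves w ≡ oddPairs descent w + oddPairs enters (sw′ w)
  leaves-odd []      = refl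
  leaves-odd (x ∷ r) = leaves-even r

  -- Along a word, leaving and entering alternate: their counts differ by
  -- whether the word starts, resp. ends, inside the set.
  telescope : {m : ℕ} (x : A) (r : Vec A m) →
    allPairs leaves (x ∷ r) + 𝟙 (b (V.last (x ∷ r))) ≡ allPairs enters (x ∷ r) + 𝟙 (b x)
  telescope x [] = refl
  telescope x (y ∷ r) = begin
    (leaves x y + allPairs leaves (y ∷ r)) + 𝟙 (b (V.last (y ∷ r))) ≡⟨ ℕₚ.+-assoc (leaves x y) _ _ ⟩
    leaves x y + (allPairs leaves (y ∷ r) + 𝟙 (b (V.last (y ∷ r)))) ≡⟨ cong (leaves x y +_) (telescope y r) ⟩
    leaves x y + (allPairs enters (y ∷ r) + 𝟙 (b y))               ≡⟨ x∙yz≈xz∙y (leaves x y) _ _ ⟩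
    (leaves x y + 𝟙 (b y)) + allPairs enters (y ∷ r)               ≡⟨ cong (_+ allPairs enters (y ∷ r)) step ⟩
    (enters x y + 𝟙 (b x)) + allPairs enters (y ∷ r)               ≡⟨ xy∙z≈xz∙y (enters x y) _ _ ⟩
    (enters x y + allPairs enters (y ∷ r)) + 𝟙 (b x)               ∎
    where
    open ≡-Reasoning
    step : leaves x y + 𝟙 (b y) ≡ enters x y + 𝟙 (b x)
    step with b x | b y
    ... | true  | true  = refl
    ... | true  | false = refl
    ... | false | true  = refl
    ... | false | false = refl

  descents-per-word : {m : ℕ} (w : Vec A (suc m)) → b (V.head w) ≡ true → b (V.last w) ≡ false →
    allPairs descent w + (evenPairs enters (sw w) + oddPairs enters (sw′ w)) ≡ allPairs enters w + 1
  descents-per-word w@(x ∷ r) starts-in ends-out = begin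
    allPairs descent w + (evenPairs enters (sw w) + oddPairs enters (sw′ w))
      ≡⟨ cong (_+ (evenPairs enters (sw w) + oddPairs enters (sw′ w))) (allPairs-split descent w) ⟩
    (evenPairs descent w + oddPairs descent w) + (evenPairs enters (sw w) + oddPairs enters (sw′ w))
      ≡⟨ +-interchange (evenPairs descent w) _ _ _ ⟩
    (evenPairs descent w + evenPairs enters (sw w)) + (oddPairs descent w + oddPairs enters (sw′ w))
      ≡⟨ cong₂ _+_ (leaves-even w) (leaves-odd w) ⟨
    evenPairs leaves w + oddPairs leaves w
      ≡⟨ allPairs-split leaves w ⟨
    allPairs leaves w
      ≡⟨ ℕₚ.+-identityʳ _ ⟨
    allPairs leaves w + 𝟙 false
      ≡⟨ cong (λ c → allPairs leaves w + 𝟙 c) ends-out ⟨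
    allPairs leaves w + 𝟙 (b (V.last w))
      ≡⟨ telescope x r ⟩
    allPairs enters w + 𝟙 (b x)
      ≡⟨ cong (λ c → allPairs enters w + 𝟙 c) starts-in ⟩
    allPairs enters w + 1 ∎
    where open ≡-Reasoning

  descent-spec : ∀ x y {D : Set} (D? : Dec D) →
    (D → b x ≡ true × b y ≡ false × x ≺ y) → (b x ≡ true → b y ≡ false → x ≺ y → D) →
    𝟙 (does D?) ≡ descent x y
  descent-spec x y D? sound complete with D? | b x | b y | x ≺? y
  ... | yes d   | _     | _     | no x⊀y = ⊥-elim (x⊀y (proj₂ (proj₂ (sound d))))
  ... | yes d   | false | _     | _      = case proj₁ (sound d) of λ ()
  ... | yes d   | true  | true  | _      = case proj₁ (proj₂ (sound d)) of λ ()
  ... | yes _   | true  | false | yes _  = refl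
  ... | no ¬d   | true  | false | yes x≺y = ⊥-elim (¬d (complete refl refl x≺y))
  ... | no _    | true  | false | no _   = refl
  ... | no _    | true  | true  | _      = refl
  ... | no _    | false | _     | _      = refl

  count-along : {Q : A → Set} (Q? : U.Decidable Q) (g : A → A → ℕ) {k : ℕ} (v : Vec A k) →
    (∀ i j → toℕ j ≡ suc (toℕ i) → 𝟙 (does (Q? (V.lookup v i))) ≡ g (V.lookup v i) (V.lookup v j)) →
    (∀ i → (∀ (j : Fin k) → toℕ j ≢ suc (toℕ i)) → ¬ Q (V.lookup v i)) →
    length (filter Q? (List.tabulate (V.lookup v))) ≡ allPairs g v
  count-along Q? g []          _    _    = refl
  count-along Q? g (x ∷ [])    _    last with Q? x
  ... | yes q = ⊥-elim (last zero (λ { zero () }) q)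
  ... | no  _ = refl
  count-along Q? g (x ∷ y ∷ r) pair last =
    trans (length-filter-∷ x _) (cong₂ _+_ (pair zero (suc zero) refl)
      (count-along Q? g (y ∷ r) (λ i j eq → pair (suc i) (suc j) (cong suc eq))
        (λ i no-succ → last (suc i) λ { zero () ; (suc j) eq → no-succ j (ℕₚ.suc-injective eq) })))
    where
    length-filter-∷ : ∀ x xs → length (filter Q? (x ∷ xs)) ≡ 𝟙 (does (Q? x)) + length (filter Q? xs)
    length-filter-∷ x xs with does (Q? x)
    ... | true  = refl
    ... | false = refl

  module _ {m : ℕ} (O : List (Vec A (suc m))) (uO : Unique O)
           (linear : ∀ {w} → w ∈ O → LinWord w)
           (sw-closed : ∀ {w} → w ∈ O → sw w ∈ O) (sw′-closed : ∀ {w} → w ∈ O → sw′ w ∈ O)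
           (starts-in : ∀ {w} → w ∈ O → b (V.head w) ≡ true)
           (ends-out : ∀ {w} → w ∈ O → b (V.last w) ≡ false) where

    private
      ∑ : (Vec A (suc m) → ℕ) → ℕ
      ∑ f = sum (map f O)

    descents-average-one : ∑ (allPairs descent) ≡ length O
    descents-average-one = ℕₚ.+-cancelʳ-≡ (∑ (allPairs enters)) _ _ (begin
      ∑ (allPairs descent) + ∑ (allPairs enters)
        ≡⟨ cong (∑ (allPairs descent) +_) (trans (sum-map-cong (allPairs-split enters)) (sum-map-+ _ _ O)) ⟩
      ∑ (allPairs descent) + (∑ (evenPairs enters) + ∑ (oddPairs enters))
        ≡⟨ cong₂ (λ s t → ∑ (allPairs descent) + (s + t))
             (sum-involution sw (evenPairs enters) uO sw-closed (λ w∈ → sw-involutive _ (linear w∈)))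
             (sum-involution sw′ (oddPairs enters) uO sw′-closed (λ w∈ → sw′-involutive _ (linear w∈))) ⟨
      ∑ (allPairs descent) + (∑ (evenPairs enters ∘ sw) + ∑ (oddPairs enters ∘ sw′))
        ≡⟨ cong (∑ (allPairs descent) +_) (sum-map-+ _ _ O) ⟨
      ∑ (allPairs descent) + ∑ (λ w → evenPairs enters (sw w) + oddPairs enters (sw′ w))
        ≡⟨ sum-map-+ _ _ O ⟨
      ∑ (λ w → allPairs descent w + (evenPairs enters (sw w) + oddPairs enters (sw′ w)))
        ≡⟨ cong sum (map-cong-local
             (All.tabulate λ {w} w∈ → descents-per-word w (starts-in w∈) (ends-out w∈))) ⟩
      ∑ (λ w → allPairs enters w + 1)
        ≡⟨ sum-map-+ _ _ O ⟩
      ∑ (allPairs enters) + ∑ (λ _ → 1)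
        ≡⟨ cong (∑ (allPairs enters) +_) (sum-ones O) ⟩
      ∑ (allPairs enters) + length O
        ≡⟨ ℕₚ.+-comm (∑ (allPairs enters)) _ ⟩
      length O + ∑ (allPairs enters) ∎)
      where
      open ≡-Reasoning
      sum-map-cong : {f g : Vec A (suc m) → ℕ} → (∀ w → f w ≡ g w) → ∑ f ≡ ∑ g
      sum-map-cong f≗g = cong sum (map-cong f≗g O)

injective⇒surjective : {k : ℕ} (f : Fin k → Fin k) → (∀ i j → f i ≡ f j → i ≡ j) →
  ∀ y → ∃ λ i → f i ≡ y
injective⇒surjective {zero}  f inj ()
injective⇒surjective {suc k} f inj y with Finₚ.any? (λ i → f i Fin.≟ y)
... | yes hit = hit
... | no  miss = ⊥-elim (ℕₚ.n≮n k (Finₚ.injective⇒≤ {f = squeeze}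
                   λ {i} {j} eq → inj i j (Finₚ.punchOut-injective (avoids i) (avoids j) eq)))
  where
  avoids : ∀ i → y ≢ f i
  avoids i y≡fi = miss (i , sym y≡fi)
  squeeze : Fin (suc k) → Fin k
  squeeze i = Fin.punchOut (avoids i)

module LinearExtensions {m : ℕ} (P : FinPoset (suc m)) where
  open FinPoset P using (_≼_)
  open Words (_≺_ P) (_≺?_ P) public
  open Parity

  Word : Set
  Word = Vec (Fin (suc m)) (suc m)

  linExt⇒linWord : {w : Word} → IsLinExt P w → LinWord w
  linExt⇒linWord {w} = indexLinear⇒linWord w

  linWord⇒linExt : {w : Word} → LinWord w → IsLinExt P w
  linWord⇒linExt {w} = linWord⇒indexLinear (λ (_ , x≢x) → x≢x refl) w

  occurs : {w : Word} → IsLinExt P w → ∀ p → p V∈ w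
  occurs {w} (inj , _) p with i , wi≡p ← injective⇒surjective (V.lookup w) inj p =
    subst (_V∈ w) wi≡p (V∈-lookup i w)

  -- On a linear extension τ_i is swIf at positions i-1, i: the swap produces
  -- a linear extension exactly when the two elements are incomparable.
  private
    τ-cases : {w : Word} → IsLinExt P w → (k : ℕ) (d : Dec (IsLinExt P (swapAdj k w))) →
      (if does d then swapAdj k w else w) ≡ swIf k w
    τ-cases lw k d with swapAdj-linear k (linExt⇒linWord lw) | d
    ... | inj₁ (_ , eq)    | yes _   = sym eq
    ... | inj₁ (lin , _)   | no ¬le  = ⊥-elim (¬le (linWord⇒linExt lin))
    ... | inj₂ (¬lin , _)  | yes le  = ⊥-elim (¬lin (linExt⇒linWord le))
    ... | inj₂ (_ , eq)    | no _    = sym eq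

    τ-linExt′ : {w : Word} → IsLinExt P w → (k : ℕ) (d : Dec (IsLinExt P (swapAdj k w))) →
      IsLinExt P (if does d then swapAdj k w else w)
    τ-linExt′ lw k (yes le) = le
    τ-linExt′ lw k (no _)   = lw

  τ-swIf : {w : Word} → IsLinExt P w → ∀ i → τ P i w ≡ swIf (i ∸ 1) w
  τ-swIf {w} lw i = τ-cases lw (i ∸ 1) (isLinExt? P (swapAdj (i ∸ 1) w))

  τ-linExt : {w : Word} → IsLinExt P w → ∀ i → IsLinExt P (τ P i w)
  τ-linExt {w} lw i = τ-linExt′ lw (i ∸ 1) (isLinExt? P (swapAdj (i ∸ 1) w))

  applyAll-linExt : {w : Word} → IsLinExt P w → ∀ is → IsLinExt P (applyAll P is w)
  applyAll-linExt lw []       = lw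
  applyAll-linExt lw (i ∷ is) = τ-linExt (applyAll-linExt lw is) i

  swIfLabels : List ℕ → Word → Word
  swIfLabels is w = List.foldr (λ i → swIf (i ∸ 1)) w is

  applyAll-swIf : {w : Word} → IsLinExt P w → ∀ is → applyAll P is w ≡ swIfLabels is w
  applyAll-swIf lw []       = refl
  applyAll-swIf lw (i ∷ is) =
    trans (τ-swIf (applyAll-linExt lw is) i) (cong (swIf (i ∸ 1)) (applyAll-swIf lw is))

  oddLabels evenLabels : List ℕ
  oddLabels  = filter (λ i → isOdd i Bool.≟ true) (labels P)
  evenLabels = filter (λ i → isOdd i Bool.≟ false) (labels P)

  τₒ-sw : {w : Word} → IsLinExt P w → τₒ P w ≡ sw w
  τₒ-sw {w} lw = begin
    τₒ P w                                           ≡⟨ applyAll-swIf lw oddLabels ⟩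
    swIfLabels oddLabels w                           ≡⟨ cong (λ is → swIfLabels is w) (odd-labels m) ⟩
    swIfLabels (map suc (evenPositions m)) w         ≡⟨ foldr-map _ suc w (evenPositions m) ⟩
    List.foldr swIf w (evenPositions m)              ≡⟨ foldr-swIf-even m w ⟩
    sw w                                             ∎
    where open ≡-Reasoning

  τₑ-sw′ : {w : Word} → IsLinExt P w → τₑ P w ≡ sw′ w
  τₑ-sw′ {w} lw = begin
    τₑ P w                                           ≡⟨ applyAll-swIf lw evenLabels ⟩
    swIfLabels evenLabels w                          ≡⟨ cong (λ is → swIfLabels is w) (even-labels m) ⟩
    swIfLabels (map suc (oddPositions m)) w          ≡⟨ foldr-map _ suc w (oddPositions m) ⟩
    List.foldr swIf w (oddPositions m)               ≡⟨ foldr-swIf-odd m w ⟩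
    sw′ w                                            ∎
    where open ≡-Reasoning

  τₒ-linExt : {w : Word} → IsLinExt P w → IsLinExt P (τₒ P w)
  τₒ-linExt lw = applyAll-linExt lw oddLabels

  τₑ-linExt : {w : Word} → IsLinExt P w → IsLinExt P (τₑ P w)
  τₑ-linExt lw = applyAll-linExt lw evenLabels

  τₒ-involutive : {w : Word} → IsLinExt P w → τₒ P (τₒ P w) ≡ w
  τₒ-involutive {w} lw =
    trans (τₒ-sw (τₒ-linExt lw)) (trans (cong sw (τₒ-sw lw)) (sw-involutive w (linExt⇒linWord lw)))

  τₑ-involutive : {w : Word} → IsLinExt P w → τₑ P (τₑ P w) ≡ w
  τₑ-involutive {w} lw =
    trans (τₑ-sw′ (τₑ-linExt lw)) (trans (cong sw′ (τₑ-sw′ lw)) (sw′-involutive w (linExt⇒linWord lw)))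

  private
    first-is-minimum : {k : ℕ} {x z : Fin (suc m)} {r : Vec (Fin (suc m)) k} → LinWord (x ∷ r) →
      (∀ p → z ≼ p) → z V∈ (x ∷ r) → x ≡ z
    first-is-minimum _ _ (VAny.here z≡x) = sym z≡x
    first-is-minimum {x = x} (above , _) minimum (VAny.there z∈r) =
      let (x≢z , z⊀x) = VAll.lookup above z∈r in ⊥-elim (z⊀x (minimum x , x≢z ∘ sym))

    last-is-maximum : {k : ℕ} {t : Fin (suc m)} (w : Vec (Fin (suc m)) (suc k)) → LinWord w →
      (∀ p → p ≼ t) → t V∈ w → V.last w ≡ t
    last-is-maximum (x ∷ [])    _ _ (VAny.here t≡x) = sym t≡x
    last-is-maximum (x ∷ y ∷ r) (((x≢y , y⊀x) ∷ _) , _) maximum (VAny.here refl) =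
      ⊥-elim (y⊀x (maximum y , x≢y ∘ sym))
    last-is-maximum (x ∷ y ∷ r) (_ , lr) maximum (VAny.there t∈) = last-is-maximum (y ∷ r) lr maximum t∈

  head-minimum : {w : Word} {z : Fin (suc m)} → IsLinExt P w → (∀ p → z ≼ p) → V.head w ≡ z
  head-minimum {_ ∷ _} {z} lw minimum = first-is-minimum (linExt⇒linWord lw) minimum (occurs lw z)

  last-maximum : {w : Word} {t : Fin (suc m)} → IsLinExt P w → (∀ p → p ≼ t) → V.last w ≡ t
  last-maximum {w} {t} lw maximum = last-is-maximum w (linExt⇒linWord lw) maximum (occurs lw t)

module Descents {m : ℕ} (P : FinPoset (suc m)) (I : Subset (suc m)) (ideal : IsOrderIdeal P I) where
  open FinPoset P using (_≼_)
  open LinearExtensions P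

  inI : Fin (suc m) → Bool
  inI = V.lookup I

  down-closed : ∀ {x y} → _≺_ P x y → inI y ≡ true → inI x ≡ true
  down-closed {x} {y} (x≼y , _) y∈I = []=⇒lookup (ideal x y (lookup⇒[]= y I y∈I) x≼y)

  open Crossings (_≺_ P) (_≺?_ P) inI down-closed

  -- For consecutive positions i, i+1 of a linear extension, the element at i
  -- is an I-descent iff the pair leaves I along a ≺-step; the cover condition
  -- is automatic since nothing lies strictly between consecutive elements.
  module _ {w : Word} (lw : IsLinExt P w) {i j : Fin (suc m)} (consecutive : toℕ j ≡ suc (toℕ i)) where
    private
      x y : Fin (suc m)
      x = V.lookup w i
      y = V.lookup w j

    inDes⇒ : InDes P I w x → inI x ≡ true × inI y ≡ false × _≺_ P x y
    inDes⇒ (x∈I , i′ , j′ , wi′≡x , consecutive′ , y′∉I , x⋖y′) with proj₁ lw i′ i wi′≡x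
    ... | refl with Finₚ.toℕ-injective {i = j′} {j = j} (trans consecutive′ (sym consecutive))
    ... | refl = []=⇒lookup x∈I , ¬-true (y′∉I ∘ lookup⇒[]= y I) , proj₁ x⋖y′
      where
      ¬-true : ∀ {c} → c ≢ true → c ≡ false
      ¬-true {true}  c≢true = ⊥-elim (c≢true refl)
      ¬-true {false} _      = refl

    inDes⇐ : inI x ≡ true → inI y ≡ false → _≺_ P x y → InDes P I w x
    inDes⇐ x∈I y∉I x≺y =
      lookup⇒[]= x I x∈I , i , j , refl , consecutive , (λ y∈I → case trans (sym ([]=⇒lookup y∈I)) y∉I of λ ()) ,
      x≺y , nothing-between
      where
      nothing-between : ∀ r → ¬ (_≺_ P x r × _≺_ P r y)
      nothing-between r (x≺r , r≺y) with l , wl≡r ← injective⇒surjective (V.lookup w) (proj₁ lw) r =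
        ℕₚ.<-irrefl refl (ℕₚ.<-≤-trans (proj₂ lw l j (subst (λ s → _≺_ P s y) (sym wl≡r) r≺y))
                          (subst (_≤ toℕ l) (sym consecutive) (proj₂ lw i l (subst (_≺_ P x) (sym wl≡r) x≺r))))

  inDes-last : {w : Word} → IsLinExt P w →
    ∀ i → (∀ (j : Fin (suc m)) → toℕ j ≢ suc (toℕ i)) → ¬ InDes P I w (V.lookup w i)
  inDes-last lw i no-succ (_ , i′ , j′ , wi′≡wi , consecutive′ , _) with proj₁ lw i′ i wi′≡wi
  ... | refl = no-succ j′ consecutive′

  desCount-pairs : {w : Word} → IsLinExt P w → desCount P I w ≡ allPairs descent w
  desCount-pairs {w} lw = begin
    length (filter (inDes? P I w) (List.allFin (suc m)))
      ≡⟨ ↭-length (filter-↭ (inDes? P I w) allFin↭w) ⟩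
    length (filter (inDes? P I w) (List.tabulate (V.lookup w)))
      ≡⟨ count-along (inDes? P I w) descent w
           (λ i j consecutive → descent-spec _ _ (inDes? P I w (V.lookup w i))
              (inDes⇒ {w} lw consecutive) (inDes⇐ {w} lw consecutive))
           (inDes-last {w} lw) ⟩
    allPairs descent w ∎
    where
    open ≡-Reasoning
    allFin↭w : List.allFin (suc m) ↭ List.tabulate (V.lookup w)
    allFin↭w = ListFacts.unique-↭ (UniqueP.allFin⁺ (suc m)) (UniqueP.tabulate⁺ (λ {i} {j} → proj₁ lw i j))
      (λ {p} _ → let i , wi≡p = injective⇒surjective (V.lookup w) (proj₁ lw) p in
                 subst (_∈ List.tabulate (V.lookup w)) wi≡p (∈-tabulate⁺ {f = V.lookup w} i))
      (λ {p} _ → ∈-allFin p)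

  homomesy : HasMinimum P → HasMaximum P → Nonempty I → (∃ λ p → p ∉ I) →
    (O : List Word) → Unique O → (∀ {w} → w ∈ O → IsLinExt P w) →
    (∀ {w} → w ∈ O → τₒ P w ∈ O) → (∀ {w} → w ∈ O → τₑ P w ∈ O) →
    sum (map (desCount P I) O) ≡ length O
  homomesy (z , minimum) (t , maximum) (q , q∈I) (p , p∉I) O uO linear τₒ-closed τₑ-closed = begin
    sum (map (desCount P I) O)     ≡⟨ cong sum (map-cong-local
                                        (All.tabulate λ {w} w∈ → desCount-pairs {w} (linear w∈))) ⟩
    sum (map (allPairs descent) O) ≡⟨ descents-average-one O uO (linExt⇒linWord ∘ linear)
                                        sw-closed sw′-closed starts-in ends-out ⟩
    length O                       ∎
    where
    open ≡-Reasoning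
    z∈I : inI z ≡ true
    z∈I = []=⇒lookup (ideal z q q∈I (minimum q))
    t∉I : inI t ≡ false
    t∉I with inI t in t∈I?
    ... | true  = ⊥-elim (p∉I (ideal p t (lookup⇒[]= t I t∈I?) (maximum p)))
    ... | false = refl
    sw-closed : ∀ {w} → w ∈ O → sw w ∈ O
    sw-closed {w} w∈ = subst (_∈ O) (τₒ-sw {w} (linear w∈)) (τₒ-closed w∈)
    sw′-closed : ∀ {w} → w ∈ O → sw′ w ∈ O
    sw′-closed {w} w∈ = subst (_∈ O) (τₑ-sw′ {w} (linear w∈)) (τₑ-closed w∈)
    starts-in : ∀ {w} → w ∈ O → inI (V.head w) ≡ true
    starts-in {w} w∈ = trans (cong inI (head-minimum {w} (linear w∈) minimum)) z∈I
    ends-out : ∀ {w} → w ∈ O → inI (V.last w) ≡ false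
    ends-out {w} w∈ = trans (cong inI (last-maximum {w} (linear w∈) maximum)) t∉I

-- With F = ρ ∘ σ, the
-- orbit of w consists of the Fᵏ w and σ (Fᵏ w).  By the pigeonhole
-- principle F is periodic on w, which bounds k and makes orbits decidable;
-- filtering a fixed enumeration then gives every orbit a canonical list.
module InvolutionOrbits {A : Set} (_≟_ : DecidableEquality A)
    (U : List A) (U-unique : Unique U) (U-complete : ∀ x → x ∈ U)
    (Good : A → Set) (σ ρ : A → A)
    (σ-good : ∀ {x} → Good x → Good (σ x)) (ρ-good : ∀ {x} → Good x → Good (ρ x))
    (σ-involutive : ∀ {x} → Good x → σ (σ x) ≡ x) (ρ-involutive : ∀ {x} → Good x → ρ (ρ x) ≡ x) where

  F G : A → A
  F = ρ ∘ σ
  G = σ ∘ ρ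

  F^ G^ : ℕ → A → A
  F^ zero    x = x
  F^ (suc k) x = F (F^ k x)
  G^ zero    x = x
  G^ (suc k) x = G^ k (G x)

  F^-good : ∀ k {x} → Good x → Good (F^ k x)
  F^-good zero    gx = gx
  F^-good (suc k) gx = ρ-good (σ-good (F^-good k gx))

  F^-+ : ∀ j k x → F^ (j + k) x ≡ F^ j (F^ k x)
  F^-+ zero    k x = refl
  F^-+ (suc j) k x = cong F (F^-+ j k x)

  G^-F^ : ∀ k {x} → Good x → G^ k (F^ k x) ≡ x
  G^-F^ zero    gx = refl
  G^-F^ (suc k) {x} gx = trans (cong (G^ k ∘ σ) (ρ-involutive (σ-good (F^-good k gx))))
                               (trans (cong (G^ k) (σ-involutive (F^-good k gx))) (G^-F^ k gx))

  F^-injective : ∀ k {x y} → Good x → Good y → F^ k x ≡ F^ k y → x ≡ y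
  F^-injective k {x} {y} gx gy eq = trans (sym (G^-F^ k gx)) (trans (cong (G^ k) eq) (G^-F^ k gy))

  -- F returns to every good element: two of F⁰ w, …, Fᴺ w coincide
  -- (N = |U|), and F is injective.
  private
    position : A → Fin (suc (length U)) → Fin (length U)
    position w k = index (U-complete (F^ (toℕ k) w))

  period : ∀ {w} → Good w → ∃ λ p → F^ (suc p) w ≡ w
  period {w} gw = let i , j , i<j , same-index = Finₚ.pigeonhole (ℕₚ.n<1+n (length U)) (position w)
                      d , i+d≡j = ℕₚ.m≤n⇒∃[o]m+o≡n i<j
    in d , F^-injective (toℕ i) (F^-good (suc d) gw) gw (begin
    F^ (toℕ i) (F^ (suc d) w)    ≡⟨ F^-+ (toℕ i) (suc d) w ⟨
    F^ (toℕ i + suc d) w         ≡⟨ cong (λ k → F^ k w) (trans (ℕₚ.+-suc (toℕ i) d) i+d≡j) ⟩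
    F^ (toℕ j) w                 ≡⟨ lookup-index (U-complete (F^ (toℕ j) w)) ⟩
    List.lookup U (position w j) ≡⟨ cong (List.lookup U) same-index ⟨
    List.lookup U (position w i) ≡⟨ lookup-index (U-complete (F^ (toℕ i) w)) ⟨
    F^ (toℕ i) w                 ∎)
    where open ≡-Reasoning

  F^-periodic : ∀ {w} p → F^ (suc p) w ≡ w → ∀ k → F^ k w ≡ F^ (k % suc p) w
  F^-periodic {w} p returns k = begin
    F^ k w                                   ≡⟨ cong (λ l → F^ l w) (m≡m%n+[m/n]*n k (suc p)) ⟩
    F^ (k % suc p + (k / suc p) * suc p) w   ≡⟨ F^-+ (k % suc p) _ w ⟩
    F^ (k % suc p) (F^ ((k / suc p) * suc p) w) ≡⟨ cong (F^ (k % suc p)) (multiples (k / suc p)) ⟩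
    F^ (k % suc p) w                         ∎
    where
    open ≡-Reasoning
    multiples : ∀ q → F^ (q * suc p) w ≡ w
    multiples zero    = refl
    multiples (suc q) = trans (F^-+ (suc p) (q * suc p) w) (trans (cong (F^ (suc p)) (multiples q)) returns)

  Orbit : A → A → Set
  Orbit w v = ∃ λ k → v ≡ F^ k w ⊎ v ≡ σ (F^ k w)

  orbit-refl : ∀ {w} → Orbit w w
  orbit-refl = 0 , inj₁ refl

  orbit-good : ∀ {w v} → Good w → Orbit w v → Good v
  orbit-good gw (k , inj₁ refl) = F^-good k gw
  orbit-good gw (k , inj₂ refl) = σ-good (F^-good k gw)

  -- The orbit of a good w is closed under σ and ρ (the latter uses the period),
  -- hence under F and G.
  module _ {w : A} (gw : Good w) where
    σ-closed : ∀ {v} → Orbit w v → Orbit w (σ v)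
    σ-closed (k , inj₁ refl) = k , inj₂ refl
    σ-closed (k , inj₂ refl) = k , inj₁ (σ-involutive (F^-good k gw))

    ρ-closed : ∀ {v} → Orbit w v → Orbit w (ρ v)
    ρ-closed (suc k , inj₁ refl) = k , inj₂ (ρ-involutive (σ-good (F^-good k gw)))
    ρ-closed (zero  , inj₁ refl) with p , returns ← period gw =
      p , inj₂ (trans (cong ρ (sym returns)) (ρ-involutive (σ-good (F^-good p gw))))
    ρ-closed (k , inj₂ refl) = suc k , inj₁ refl

    F^-closed : ∀ j {v} → Orbit w v → Orbit w (F^ j v)
    F^-closed zero    o = o
    F^-closed (suc j) o = ρ-closed (σ-closed (F^-closed j o))

    G^-closed : ∀ j {v} → Orbit w v → Orbit w (G^ j v)
    G^-closed zero    o = o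
    G^-closed (suc j) o = G^-closed j (σ-closed (ρ-closed o))

  orbit-trans : ∀ {w v u} → Good w → Orbit w v → Orbit v u → Orbit w u
  orbit-trans gw o (j , inj₁ refl) = F^-closed gw j o
  orbit-trans gw o (j , inj₂ refl) = σ-closed gw (F^-closed gw j o)

  orbit-sym : ∀ {w v} → Good w → Orbit w v → Orbit v w
  orbit-sym {w} gw o@(k , inj₁ refl) =
    subst (Orbit _) (G^-F^ k gw) (G^-closed (orbit-good gw o) k orbit-refl)
  orbit-sym {w} gw o@(k , inj₂ refl) =
    subst (Orbit _) (trans (cong (G^ k) (σ-involutive (F^-good k gw))) (G^-F^ k gw))
      (G^-closed (orbit-good gw o) k (σ-closed (orbit-good gw o) orbit-refl))

  -- Orbit membership is decidable: by periodicity k may be taken below the period.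
  orbit? : ∀ {w} → Good w → U.Decidable (Orbit w)
  orbit? {w} gw v with p , returns ← period gw =
    Dec.map′ (λ (k , v≡) → toℕ k , v≡) reduce
      (Finₚ.any? λ (k : Fin (suc p)) → (v ≟ F^ (toℕ k) w) ⊎-dec (v ≟ σ (F^ (toℕ k) w)))
    where
    reduce : Orbit w v → ∃ λ (k : Fin (suc p)) → v ≡ F^ (toℕ k) w ⊎ v ≡ σ (F^ (toℕ k) w)
    reduce (k , v≡) = Fin.fromℕ< (m%n<n k (suc p)) ,
      subst (λ l → v ≡ F^ l w ⊎ v ≡ σ (F^ l w)) (sym (Finₚ.toℕ-fromℕ< (m%n<n k (suc p))))
        (Sum.map (λ v≡ → trans v≡ (F^-periodic p returns k))
                 (λ v≡ → trans v≡ (cong σ (F^-periodic p returns k))) v≡)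

  -- The canonical list of the orbit of w: it depends only on the orbit.
  -- (Opaque: it is a filter over all words and must never be unfolded.)
  opaque
    orbitList : (w : A) → Good w → List A
    orbitList w gw = filter (orbit? gw) U

    orbitList-unique : ∀ w (gw : Good w) → Unique (orbitList w gw)
    orbitList-unique w gw = UniqueP.filter⁺ (orbit? gw) U-unique

    orbitList⁺ : ∀ w (gw : Good w) {v} → Orbit w v → v ∈ orbitList w gw
    orbitList⁺ w gw o = ∈-filter⁺ (orbit? gw) (U-complete _) o

    orbitList⁻ : ∀ w (gw : Good w) {v} → v ∈ orbitList w gw → Orbit w v
    orbitList⁻ w gw v∈ = proj₂ (∈-filter⁻ (orbit? gw) {xs = U} v∈)

    orbitList-cong : ∀ {w w′} (gw : Good w) (gw′ : Good w′) → Orbit w w′ → orbitList w gw ≡ orbitList w′ gw′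
    orbitList-cong gw gw′ o = filter-≐ (orbit? gw) (orbit? gw′)
      ((λ wv → orbit-trans gw′ (orbit-sym gw o) wv) , (λ w′v → orbit-trans gw o w′v)) U

  Move : A → A → Set
  Move x y = y ≡ σ x ⊎ y ≡ ρ x

  orbit⇒closure : ∀ {w v} → Orbit w v → EqClosure Move w v
  orbit⇒closure {w} (k , inj₁ refl) = iterates k
    where
    iterates : ∀ k → EqClosure Move w (F^ k w)
    iterates zero    = ε
    iterates (suc k) = iterates k ◅◅ (fwd (inj₁ refl) ◅ fwd (inj₂ refl) ◅ ε)
  orbit⇒closure (k , inj₂ refl) = orbit⇒closure (k , inj₁ refl) ◅◅ (fwd (inj₁ refl) ◅ ε)

module AllWords (n : ℕ) where

  allWords : (k : ℕ) → List (Vec (Fin n) k)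
  allWords zero    = [] ∷ []
  allWords (suc k) = map (uncurry _∷_) (List.cartesianProduct (List.allFin n) (allWords k))

  allWords-unique : ∀ k → Unique (allWords k)
  allWords-unique zero    = All.[] ∷ []
  allWords-unique (suc k) = UniqueP.map⁺ (λ eq → ×-≡,≡→≡ (Vecₚ.∷-injective eq))
    (UniqueP.cartesianProduct⁺ (UniqueP.allFin⁺ n) (allWords-unique k))

  allWords-complete : ∀ k (w : Vec (Fin n) k) → w ∈ allWords k
  allWords-complete zero    []      = here refl
  allWords-complete (suc k) (x ∷ w) =
    ∈-map⁺ (uncurry _∷_) (∈-cartesianProduct⁺ (∈-allFin x) (allWords-complete k w))

-- Within each ⟨τₒ, τₑ⟩-orbit the pairs
-- (linear extension, I-descent) are exactly as many as the linear extensions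
-- (homomesy), so Φ can match the two canonical lists position by position.
module DescentBijection {m : ℕ} (P : FinPoset (suc m)) (I : Subset (suc m)) (ideal : IsOrderIdeal P I)
    (has-min : HasMinimum P) (has-max : HasMaximum P) (I-nonempty : Nonempty I) (I-proper : ∃ λ p → p ∉ I) where
  open LinearExtensions P using (Word; τₒ-linExt; τₑ-linExt; τₒ-involutive; τₑ-involutive)
  open Descents P I ideal using (homomesy)
  open AllWords (suc m)
  open InvolutionOrbits (Vecₚ.≡-dec Fin._≟_) (allWords (suc m)) (allWords-unique (suc m)) (allWords-complete (suc m))
         (IsLinExt P) (τₒ P) (τₑ P) τₒ-linExt τₑ-linExt τₒ-involutive τₑ-involutive
  open ListFacts

  private
    Elt : Set
    Elt = Fin (suc m)
    Q? : U.Decidable (λ ((w , p) : Word × Elt) → InDes P I w p)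
    Q? (w , p) = inDes? P I w p

  DescentPairs : List Word → List (Word × Elt)
  DescentPairs Ws = filter Q? (List.cartesianProduct Ws (List.allFin (suc m)))

  descentPairs-length : ∀ Ws → length (DescentPairs Ws) ≡ sum (map (desCount P I) Ws)
  descentPairs-length []       = refl
  descentPairs-length (w ∷ Ws) = begin
    length (filter Q? (map (w ,_) (List.allFin (suc m)) ++ List.cartesianProduct Ws (List.allFin (suc m))))
      ≡⟨ cong length (filter-++ Q? (map (w ,_) (List.allFin (suc m))) _) ⟩
    length (filter Q? (map (w ,_) (List.allFin (suc m))) ++ DescentPairs Ws)
      ≡⟨ length-++ (filter Q? (map (w ,_) (List.allFin (suc m)))) ⟩
    length (filter Q? (map (w ,_) (List.allFin (suc m)))) + length (DescentPairs Ws)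
      ≡⟨ cong₂ _+_ (length-filter-map Q? (w ,_) (List.allFin (suc m))) (descentPairs-length Ws) ⟩
    desCount P I w + sum (map (desCount P I) Ws) ∎
    where open ≡-Reasoning

  descentPairs-unique : ∀ {Ws} → Unique Ws → Unique (DescentPairs Ws)
  descentPairs-unique uWs = UniqueP.filter⁺ Q? (UniqueP.cartesianProduct⁺ uWs (UniqueP.allFin⁺ (suc m)))

  descentPairs⁺ : ∀ {Ws w p} → w ∈ Ws → InDes P I w p → (w , p) ∈ DescentPairs Ws
  descentPairs⁺ {p = p} w∈ dp = ∈-filter⁺ Q? (∈-cartesianProduct⁺ w∈ (∈-allFin p)) dp

  descentPairs⁻ : ∀ {Ws w p} → (w , p) ∈ DescentPairs Ws → w ∈ Ws × InDes P I w p
  descentPairs⁻ {Ws} x∈ = let x∈′ , dp = ∈-filter⁻ Q? {xs = List.cartesianProduct Ws _} x∈ in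
    proj₁ (∈-cartesianProduct⁻ Ws _ x∈′) , dp

  orbit-homomesy : ∀ w (lw : IsLinExt P w) → sum (map (desCount P I) (orbitList w lw)) ≡ length (orbitList w lw)
  orbit-homomesy w lw = homomesy has-min has-max I-nonempty I-proper (orbitList w lw) (orbitList-unique w lw)
    (λ v∈ → orbit-good lw (orbitList⁻ w lw v∈))
    (λ v∈ → orbitList⁺ w lw (σ-closed lw (orbitList⁻ w lw v∈)))
    (λ v∈ → orbitList⁺ w lw (ρ-closed lw (orbitList⁻ w lw v∈)))

  orbit-count : ∀ w (lw : IsLinExt P w) → length (DescentPairs (orbitList w lw)) ≡ length (orbitList w lw)
  orbit-count w lw = trans (descentPairs-length (orbitList w lw)) (orbit-homomesy w lw)

  module Match (Ws : List Word) .(same-length : length (DescentPairs Ws) ≡ length Ws) =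
    IndexMatching (DescentPairs Ws) Ws same-length

  Φ : (w : Word) → IsLinExt P w → (p : Elt) → InDes P I w p → Word
  Φ w lw p dp = Match.match (orbitList w lw) (orbit-count w lw) (descentPairs⁺ (orbitList⁺ w lw orbit-refl) dp)

  Φ-orbit : ∀ w lw p dp → Orbit w (Φ w lw p dp)
  Φ-orbit w lw p dp = orbitList⁻ w lw (Match.match-∈ (orbitList w lw) (orbit-count w lw) _)

  Φ-reindex : ∀ w lw p dp (Ws : List Word) → orbitList w lw ≡ Ws →
    .(same-length : length (DescentPairs Ws) ≡ length Ws) (x∈ : (w , p) ∈ DescentPairs Ws) →
    Φ w lw p dp ≡ Match.match Ws same-length x∈
  Φ-reindex w lw p dp _ refl same-length x∈ =
    Match.match-irrelevant (orbitList w lw) same-length (descentPairs-unique (orbitList-unique w lw)) _ x∈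

  Φ-injective : ∀ w lw p dp w′ lw′ p′ dp′ → Φ w lw p dp ≡ Φ w′ lw′ p′ dp′ → w ≡ w′ × p ≡ p′
  Φ-injective w lw p dp w′ lw′ p′ dp′ eq = ×-≡,≡←≡ (Match.match-injective (orbitList w lw) (orbit-count w lw)
      (orbitList-unique w lw) _ w′p′∈
      (trans eq (Φ-reindex w′ lw′ p′ dp′ (orbitList w lw) same-list (orbit-count w lw) w′p′∈)))
    where
    w~w′ : Orbit w w′
    w~w′ = orbit-trans lw (Φ-orbit w lw p dp)
             (orbit-sym lw′ (subst (Orbit w′) (sym eq) (Φ-orbit w′ lw′ p′ dp′)))
    same-list : orbitList w′ lw′ ≡ orbitList w lw
    same-list = sym (orbitList-cong lw lw′ w~w′)
    w′p′∈ : (w′ , p′) ∈ DescentPairs (orbitList w lw)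
    w′p′∈ = descentPairs⁺ (orbitList⁺ w lw w~w′) dp′

  Φ-surjective : ∀ M → IsLinExt P M → ∃ λ w → ∃ λ lw → ∃ λ p → ∃ λ dp → Φ w lw p dp ≡ M
  Φ-surjective M lM = from-pair (Match.match-surjective (orbitList M lM) (orbit-count M lM) (orbitList⁺ M lM orbit-refl))
    where
    from-pair : (∃ λ x → Σ (x ∈ DescentPairs (orbitList M lM)) λ x∈ →
                   Match.match (orbitList M lM) (orbit-count M lM) x∈ ≡ M) →
      ∃ λ w → ∃ λ lw → ∃ λ p → ∃ λ dp → Φ w lw p dp ≡ M
    from-pair ((w , p) , wp∈ , matched) =
      w , lw , p , dp , trans (Φ-reindex w lw p dp (orbitList M lM) same-list (orbit-count M lM) wp∈) matched
      where
      M~w : Orbit M w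
      M~w = orbitList⁻ M lM (proj₁ (descentPairs⁻ {orbitList M lM} wp∈))
      dp : InDes P I w p
      dp = proj₂ (descentPairs⁻ {orbitList M lM} wp∈)
      lw : IsLinExt P w
      lw = orbit-good lM M~w
      same-list : orbitList w lw ≡ orbitList M lM
      same-list = orbitList-cong lw lM (orbit-sym lM M~w)

  Φ-linExt : ∀ w lw p dp → IsLinExt P (Φ w lw p dp)
  Φ-linExt w lw p dp = orbit-good lw (Φ-orbit w lw p dp)

  Φ-sameOrbit : ∀ w lw p dp → SameOrbit P w (Φ w lw p dp)
  Φ-sameOrbit w lw p dp = orbit⇒closure (Φ-orbit w lw p dp)

  orbit-average : ∀ w → IsLinExt P w → (O : List Word) → Unique O →
    (∀ M → M ∈ O ⇔ (IsLinExt P M × SameOrbit P w M)) → sum (map (desCount P I) O) ≡ length O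
  orbit-average w lw O uO O⇔ = homomesy has-min has-max I-nonempty I-proper O uO
    (λ v∈ → proj₁ (to v∈))
    (λ {v} v∈ → from (τₒ-linExt (proj₁ (to v∈)) , (proj₂ (to v∈) ◅◅ (fwd (inj₁ refl) ◅ ε))))
    (λ {v} v∈ → from (τₑ-linExt (proj₁ (to v∈)) , (proj₂ (to v∈) ◅◅ (fwd (inj₂ refl) ◅ ε))))
    where
    to : ∀ {M} → M ∈ O → IsLinExt P M × SameOrbit P w M
    to {M} = Equivalence.to (O⇔ M)
    from : ∀ {M} → IsLinExt P M × SameOrbit P w M → M ∈ O
    from {M} = Equivalence.from (O⇔ M)

theorem5p7 : (n : ℕ) (P : FinPoset n) → HasMinimum P → HasMaximum P →
    (I : Subset n) → IsOrderIdeal P I → Nonempty I → (∃ λ p → p ∉ I) →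
    (Σ ((w : Vec (Fin n) n) → IsLinExt P w → (p : Fin n) → InDes P I w p → Vec (Fin n) n) λ Φ →
        (∀ w lw p dp → IsLinExt P (Φ w lw p dp))
      × (∀ w lw p dp w' lw' p' dp' → Φ w lw p dp ≡ Φ w' lw' p' dp' → (w ≡ w') × (p ≡ p'))
      × (∀ M → IsLinExt P M → ∃ λ w → ∃ λ lw → ∃ λ p → ∃ λ dp → Φ w lw p dp ≡ M)
      × (∀ w lw p dp → SameOrbit P w (Φ w lw p dp)))
    × (∀ w → IsLinExt P w → (O : List (Vec (Fin n) n)) → Unique O →
        (∀ M → (ListMem._∈_ M O) ⇔ (IsLinExt P M × SameOrbit P w M)) →
        sum (map (desCount P I) O) ≡ length O)
theorem5p7 zero    P _ _ I _ (() , _) _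
theorem5p7 (suc m) P has-min has-max I ideal I-nonempty I-proper =
  (Φ , Φ-linExt , Φ-injective , Φ-surjective , Φ-sameOrbit) , orbit-average
  where open DescentBijection P I ideal has-min has-max I-nonempty I-proper
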